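{- Suppose $V_1,\dots,V_t$ are pairwise disjoint finite sets with $|V_i|\ge2$ for all $i\in[t]$. Then for any integer $\ell\ge2$, the number of subsets $S\subseteq\bigcup_{i\in[t]}V_i$ with $|S|=\ell$ and $|S\cap V_i|\ne1$ for every $i$ is at most \[\left(\frac{20}{\ell}\big(|V_1|^2+\dots+|V_t|^2\big)\right)^{\ell/2}.\] -}

module Defs where

open import Data.Nat using (ℕ; zero; suc; _^_)
open import Data.Fin using (Fin; _≟_)
open import Data.Fin.Subset using (Subset; inside; outside; ∣_∣; _∩_)
open import Data.Fin.Properties using (all?)
open import Data.Vec using (Vec; []; _∷_; tabulate; sum)
open import Data.List using (List; []; _∷_; map; _++_; filter; length)
open import Data.Product using (_×_)
open import Relation.Nullary using (¬_; Dec; yes; no)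
open import Relation.Nullary.Decidable using (_×-dec_; ¬?; ⌊_⌋)
open import Relation.Binary.PropositionalEquality using (_≡_)
import Data.Nat as ℕ
open import Data.Bool using (if_then_else_)

-- The disjoint union V₁ ∪ … ∪ V_t is modelled as Fin n; the function
-- c : Fin n → Fin t assigns each element the (unique) block containing it.
-- block c i is the subset V_i ⊆ Fin n.
block : {n t : ℕ} → (Fin n → Fin t) → Fin t → Subset n
block c i = tabulate (λ x → if ⌊ c x ≟ i ⌋ then inside else outside)

allSubsets : (n : ℕ) → List (Subset n)
allSubsets zero = [] ∷ []
allSubsets (suc n) = map (inside ∷_) (allSubsets n) ++ map (outside ∷_) (allSubsets n)

Good : {n t : ℕ} → (Fin n → Fin t) → ℕ → Subset n → Set
Good c ℓ S = (∣ S ∣ ≡ ℓ) × (∀ i → ¬ (∣ S ∩ block c i ∣ ≡ 1))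

good? : {n t : ℕ} → (c : Fin n → Fin t) → (ℓ : ℕ) → (S : Subset n) → Dec (Good c ℓ S)
good? c ℓ S = (∣ S ∣ ℕ.≟ ℓ) ×-dec all? (λ i → ¬? (∣ S ∩ block c i ∣ ℕ.≟ 1))

countGood : {n t : ℕ} → (Fin n → Fin t) → ℕ → ℕ
countGood {n} c ℓ = length (filter (good? c ℓ) (allSubsets n))

sumSq : {n t : ℕ} → (Fin n → Fin t) → ℕ
sumSq c = sum (tabulate (λ i → ∣ block c i ∣ ^ 2))

-- Rankin's trick. Give a subset S of the n-element union the weight y ^ (n ∸ ∣S∣). The sets
-- meeting no block in exactly one point have total weight ∏ᵢ Φ(∣Vᵢ∣), where
-- Φ(m) = (1 + y) ^ m − m y ^ (m − 1), and each of them of size ℓ weighs y ^ (n ∸ ℓ); so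
-- N y ^ n ≤ y ^ ℓ ∏ᵢ Φ(∣Vᵢ∣). Induction on m gives Φ(m) ≤ y ^ m (1 + 1/y²) ^ (m²), hence
-- N ≤ y ^ ℓ (1 + 1/z) ^ Q with z = y² and Q = ∑ ∣Vᵢ∣². Choosing y with Q ≤ ℓ z ≤ 4 Q and
-- using (1 + 1/z) ^ z ≤ 3 gives N² ℓ ^ ℓ ≤ (ℓ z) ^ ℓ 3 ^ e with e = 2ℓ, or e = ℓ when ℓ z > 2 Q;
-- in both cases this is at most (20 Q) ^ ℓ.

module Submission where

open import Defs
open import Data.Nat using (ℕ; zero; suc; _+_; _*_; _^_; _≤_; _<_; z≤n; s≤s; NonZero; _≤?_)
open import Data.Nat.Properties hiding (_≟_)
open import Algebra.Properties.CommutativeSemigroup *-commutativeSemigroup using (interchange; x∙yz≈y∙xz; x∙yz≈xz∙y; xy∙z≈xz∙y)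
open import Data.Nat.Tactic.RingSolver using (solve-∀)
open import Data.Fin using (Fin; zero; suc; _≟_)
import Data.Fin.Properties as Finₚ
open import Data.Fin.Subset using (Subset; inside; outside; ∣_∣; _∩_)
open import Data.Fin.Subset.Properties using (∣p∣≤n)
open import Data.Fin.Properties using (all?)
open import Data.Vec using ([]; _∷_; tabulate; sum)
open import Data.Vec.Properties using (tabulate-cong)
open import Data.List using ([]; _∷_; map; _++_; filter; length)
open import Data.List.Properties using (filter-++; length-++; filter-none)
open import Data.List.Relation.Unary.All using (universal)
open import Data.List.Relation.Unary.All.Properties using (map⁺)
open import Data.Product using (_×_; _,_; ∃)
open import Data.Sum using (inj₁; inj₂)
open import Data.Bool using (Bool; if_then_else_)
open import Function using (_∘_)
open import Relation.Nullary using (¬_; Dec; yes; no; contradiction)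
open import Relation.Nullary.Decidable using (_×-dec_; ¬?; ⌊_⌋)
open import Relation.Unary using (Decidable)
open import Relation.Binary.PropositionalEquality
import Data.Nat as ℕ

private
  variable
    t : ℕ
    A : Set

∑ : (Fin t → ℕ) → ℕ
∑ f = sum (tabulate f)

∏ : (Fin t → ℕ) → ℕ
∏ {zero} f = 1
∏ {suc t} f = f zero * ∏ (f ∘ suc)

∑-cong : {f g : Fin t → ℕ} → (∀ i → f i ≡ g i) → ∑ f ≡ ∑ g
∑-cong f≗g = cong sum (tabulate-cong f≗g)

∑-mono-≤ : {f g : Fin t → ℕ} → (∀ i → f i ≤ g i) → ∑ f ≤ ∑ g
∑-mono-≤ {zero} f≤g = ≤-refl
∑-mono-≤ {suc t} f≤g = +-mono-≤ (f≤g zero) (∑-mono-≤ (f≤g ∘ suc))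

∑-zero : ∑ {t} (λ _ → 0) ≡ 0
∑-zero {zero} = refl
∑-zero {suc t} = ∑-zero {t}

∑-incrementAt : (b : Fin t) (f g : Fin t → ℕ) →
  f b ≡ suc (g b) → (∀ i → b ≢ i → f i ≡ g i) → ∑ f ≡ suc (∑ g)
∑-incrementAt zero f g at off =
  cong₂ _+_ at (∑-cong (λ i → off (suc i) λ ()))
∑-incrementAt (suc b) f g at off = begin
  f zero + ∑ (f ∘ suc)        ≡⟨ cong₂ _+_ (off zero λ ()) (∑-incrementAt b (f ∘ suc) (g ∘ suc) at off-tail) ⟩
  g zero + suc (∑ (g ∘ suc))  ≡⟨ +-suc (g zero) _ ⟩
  suc (∑ g)                   ∎
  where
  open ≡-Reasoning
  off-tail : ∀ i → b ≢ i → f (suc i) ≡ g (suc i)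
  off-tail i b≢i = off (suc i) (b≢i ∘ Finₚ.suc-injective)

∏-cong : {f g : Fin t → ℕ} → (∀ i → f i ≡ g i) → ∏ f ≡ ∏ g
∏-cong {zero} f≗g = refl
∏-cong {suc t} f≗g = cong₂ _*_ (f≗g zero) (∏-cong (f≗g ∘ suc))

∏-positive : (f : Fin t → ℕ) → (∀ i → 1 ≤ f i) → 1 ≤ ∏ f
∏-positive {zero} f _ = ≤-refl
∏-positive {suc t} f pos = *-mono-≤ (pos zero) (∏-positive (f ∘ suc) (pos ∘ suc))

∏-*-mono-≤ : (f g h k : Fin t → ℕ) → (∀ i → f i * g i ≤ h i * k i) → ∏ f * ∏ g ≤ ∏ h * ∏ k
∏-*-mono-≤ {zero} f g h k _ = ≤-refl
∏-*-mono-≤ {suc t} f g h k le = begin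
  f zero * ∏ (f ∘ suc) * (g zero * ∏ (g ∘ suc))   ≡⟨ interchange (f zero) _ _ _ ⟩
  (f zero * g zero) * (∏ (f ∘ suc) * ∏ (g ∘ suc)) ≤⟨ *-mono-≤ (le zero) (∏-*-mono-≤ _ _ _ _ (le ∘ suc)) ⟩
  (h zero * k zero) * (∏ (h ∘ suc) * ∏ (k ∘ suc)) ≡⟨ interchange (h zero) _ _ _ ⟨
  h zero * ∏ (h ∘ suc) * (k zero * ∏ (k ∘ suc))   ∎
  where open ≤-Reasoning

∏-^ : ∀ a (F : Fin t → ℕ) → ∏ (λ i → a ^ F i) ≡ a ^ ∑ F
∏-^ {zero} a F = refl
∏-^ {suc t} a F = trans (cong (a ^ F zero *_) (∏-^ a (F ∘ suc))) (sym (^-distribˡ-+-* a (F zero) (∑ (F ∘ suc))))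

∏-linearAt : (b : Fin t) (y : ℕ) (f g h : Fin t → ℕ) →
  f b ≡ y * g b + h b → (∀ i → b ≢ i → f i ≡ g i) → (∀ i → b ≢ i → g i ≡ h i) →
  ∏ f ≡ y * ∏ g + ∏ h
∏-linearAt zero y f g h at f≗g g≗h = begin
  f zero * ∏ (f ∘ suc)                     ≡⟨ cong₂ _*_ at (∏-cong (λ i → f≗g (suc i) λ ())) ⟩
  (y * g zero + h zero) * ∏ (g ∘ suc)     ≡⟨ distrib y (g zero) (h zero) _ ⟩
  y * ∏ g + h zero * ∏ (g ∘ suc)          ≡⟨ cong (λ p → y * ∏ g + h zero * p) (∏-cong (λ i → g≗h (suc i) λ ())) ⟩
  y * ∏ g + ∏ h                            ∎
  where
  open ≡-Reasoning
  distrib : ∀ a b c d → (a * b + c) * d ≡ a * (b * d) + c * d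
  distrib = solve-∀
∏-linearAt (suc b) y f g h at f≗g g≗h = begin
  f zero * ∏ (f ∘ suc)                      ≡⟨ cong₂ _*_ (f≗g zero λ ()) (∏-linearAt b y _ _ _ at (tail f≗g) (tail g≗h)) ⟩
  g zero * (y * ∏ (g ∘ suc) + ∏ (h ∘ suc))  ≡⟨ distrib (g zero) y _ _ ⟩
  y * ∏ g + g zero * ∏ (h ∘ suc)            ≡⟨ cong (λ p → y * ∏ g + p * ∏ (h ∘ suc)) (g≗h zero λ ()) ⟩
  y * ∏ g + ∏ h                              ∎
  where
  open ≡-Reasoning
  tail : {u v : Fin (suc _) → ℕ} → (∀ i → suc b ≢ i → u i ≡ v i) → ∀ i → b ≢ i → u (suc i) ≡ v (suc i)
  tail u≗v i b≢i = u≗v (suc i) (b≢i ∘ Finₚ.suc-injective)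
  distrib : ∀ a b c d → a * (b * c + d) ≡ b * (a * c) + a * d
  distrib = solve-∀

module _ {P : A → Set} (P? : Decidable P) where

  length-filter-++ : ∀ xs ys → length (filter P? (xs ++ ys)) ≡ length (filter P? xs) + length (filter P? ys)
  length-filter-++ xs ys = trans (cong length (filter-++ P? xs ys)) (length-++ (filter P? xs))

  length-filter-map-≤ : {B : Set} {Q : B → Set} (Q? : Decidable Q) (f : B → A) → (∀ b → P (f b) → Q b) →
    ∀ xs → length (filter P? (map f xs)) ≤ length (filter Q? xs)
  length-filter-map-≤ Q? f P⇒Q [] = z≤n
  length-filter-map-≤ Q? f P⇒Q (x ∷ xs) with P? (f x) | Q? x
  ... | yes _  | yes _ = s≤s (length-filter-map-≤ Q? f P⇒Q xs)
  ... | yes p  | no ¬q = contradiction (P⇒Q x p) ¬q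
  ... | no _   | yes _ = m≤n⇒m≤1+n (length-filter-map-≤ Q? f P⇒Q xs)
  ... | no _   | no _  = length-filter-map-≤ Q? f P⇒Q xs

  length-filter-[x]-≤ : ∀ x {k} → (P x → 1 ≤ k) → length (filter P? (x ∷ [])) ≤ k
  length-filter-[x]-≤ x Px⇒1≤k with P? x
  ... | yes px = Px⇒1≤k px
  ... | no _ = z≤n

  length-filter-map-none : {B : Set} (f : B → A) → (∀ b → ¬ P (f b)) → ∀ xs → length (filter P? (map f xs)) ≡ 0
  length-filter-map-none f ¬P xs = cong length (filter-none P? (map⁺ (universal ¬P xs)))

-- block c i ≡ bit (c zero ≟ i) ∷ block (c ∘ suc) i holds by computation.
bit : Dec A → Bool
bit d = if ⌊ d ⌋ then inside else outside

bump : Dec A → ℕ → ℕ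
bump d s = if ⌊ d ⌋ then suc s else s

∣bit∷∣ : ∀ {k} (d : Dec A) (X : Subset k) → ∣ bit d ∷ X ∣ ≡ bump d ∣ X ∣
∣bit∷∣ (yes _) X = refl
∣bit∷∣ (no _) X = refl

bump-yes : (d : Dec A) → A → ∀ s → bump d s ≡ suc s
bump-yes (yes _) _ s = refl
bump-yes (no ¬a) a s = contradiction a ¬a

bump-no : (d : Dec A) → ¬ A → ∀ s → bump d s ≡ s
bump-no (yes a) ¬a s = contradiction a ¬a
bump-no (no _) _ s = refl

bump-+ : (d : Dec A) → ∀ s m → bump d s + m ≡ s + bump d m
bump-+ (yes _) s m = sym (+-suc s m)
bump-+ (no _) s m = refl

-- Φ y s m = ∑ y ^ (m ∸ ∣T∣) over T ⊆ [m] with s + ∣T∣ ≢ 1: the weight of a block of size m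
-- of which s elements have already been chosen.
Φ : ℕ → ℕ → ℕ → ℕ
Φ y s (suc m) = y * Φ y s m + Φ y (suc s) m
Φ y (suc zero) zero = 0
Φ y _ zero = 1

Φ-positive : ∀ y s → s ≢ 1 → 1 ≤ Φ y s 0
Φ-positive y zero _ = ≤-refl
Φ-positive y (suc zero) s≢1 = contradiction refl s≢1
Φ-positive y (suc (suc s)) _ = ≤-refl

Φ-bump : ∀ y s m (d : Dec A) → A → Φ y s (bump d m) ≡ y * Φ y s m + Φ y (bump d s) m
Φ-bump y s m (yes _) _ = refl
Φ-bump y s m (no ¬a) a = contradiction a ¬a

-- σ i counts the elements of the i-th block that have already been chosen.
GoodWith : ∀ {n} → (Fin n → Fin t) → (Fin t → ℕ) → ℕ → Subset n → Set
GoodWith c σ ℓ S = (∣ S ∣ ≡ ℓ) × (∀ i → σ i + ∣ S ∩ block c i ∣ ≢ 1)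

goodWith? : ∀ {n} (c : Fin n → Fin t) σ ℓ → Decidable (GoodWith c σ ℓ)
goodWith? c σ ℓ S = (∣ S ∣ ℕ.≟ ℓ) ×-dec all? (λ i → ¬? (σ i + ∣ S ∩ block c i ∣ ℕ.≟ 1))

countGoodWith : ∀ {n} → (Fin n → Fin t) → (Fin t → ℕ) → ℕ → ℕ
countGoodWith {n = n} c σ ℓ = length (filter (goodWith? c σ ℓ) (allSubsets n))

afterHead : ∀ {n} → (Fin (suc n) → Fin t) → (Fin t → ℕ) → Fin t → ℕ
afterHead c σ i = bump (c zero ≟ i) (σ i)

countGoodWithHead : ∀ {n} → (Fin (suc n) → Fin t) → (Fin t → ℕ) → ℕ → Bool → ℕ
countGoodWithHead {n = n} c σ ℓ x = length (filter (goodWith? c σ ℓ) (map (x ∷_) (allSubsets n)))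

module _ {n} (c : Fin (suc n) → Fin t) (σ : Fin t → ℕ) where

  countGoodWith-split : ∀ ℓ →
    countGoodWith c σ ℓ ≡ countGoodWithHead c σ ℓ inside + countGoodWithHead c σ ℓ outside
  countGoodWith-split ℓ =
    length-filter-++ (goodWith? c σ ℓ) (map (inside ∷_) (allSubsets n)) (map (outside ∷_) (allSubsets n))

  countGoodWithHead-inside-zero : countGoodWithHead c σ 0 inside ≡ 0
  countGoodWithHead-inside-zero =
    length-filter-map-none (goodWith? c σ 0) (inside ∷_) (λ _ → λ { (() , _) }) (allSubsets n)

  countGoodWithHead-inside-≤ : ∀ ℓ → countGoodWithHead c σ (suc ℓ) inside ≤ countGoodWith (c ∘ suc) (afterHead c σ) ℓ
  countGoodWithHead-inside-≤ ℓ =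
    length-filter-map-≤ (goodWith? c σ (suc ℓ)) (goodWith? (c ∘ suc) (afterHead c σ) ℓ) (inside ∷_) drop-head (allSubsets n)
    where
    shift : ∀ S i → σ i + ∣ (inside ∷ S) ∩ block c i ∣ ≡ afterHead c σ i + ∣ S ∩ block (c ∘ suc) i ∣
    shift S i = trans (cong (σ i +_) (∣bit∷∣ (c zero ≟ i) (S ∩ block (c ∘ suc) i)))
                      (sym (bump-+ (c zero ≟ i) (σ i) _))
    drop-head : ∀ S → GoodWith c σ (suc ℓ) (inside ∷ S) → GoodWith (c ∘ suc) (afterHead c σ) ℓ S
    drop-head S (∣S∣≡ , notOne) = suc-injective ∣S∣≡ , λ i → notOne i ∘ trans (shift S i)

  countGoodWithHead-outside-≤ : ∀ ℓ → countGoodWithHead c σ ℓ outside ≤ countGoodWith (c ∘ suc) σ ℓ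
  countGoodWithHead-outside-≤ ℓ =
    length-filter-map-≤ (goodWith? c σ ℓ) (goodWith? (c ∘ suc) σ ℓ) (outside ∷_) (λ _ good → good) (allSubsets n)

blockWeight : ℕ → ∀ {n} → (Fin n → Fin t) → (Fin t → ℕ) → ℕ
blockWeight y c σ = ∏ (λ i → Φ y (σ i) ∣ block c i ∣)

blockWeight-afterHead : ∀ y {n} (c : Fin (suc n) → Fin t) σ →
  blockWeight y c σ ≡ y * blockWeight y (c ∘ suc) σ + blockWeight y (c ∘ suc) (afterHead c σ)
blockWeight-afterHead y c σ = ∏-linearAt (c zero) y _ _ _ at f≗g g≗h
  where
  d = λ i → c zero ≟ i
  X = λ i → block (c ∘ suc) i
  at = trans (cong (Φ y (σ (c zero))) (∣bit∷∣ (d (c zero)) (X (c zero)))) (Φ-bump y _ _ (d (c zero)) refl)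
  f≗g = λ i c₀≢i → cong (Φ y (σ i)) (trans (∣bit∷∣ (d i) (X i)) (bump-no (d i) c₀≢i _))
  g≗h = λ i c₀≢i → cong (λ s → Φ y s ∣ X i ∣) (sym (bump-no (d i) c₀≢i (σ i)))

-- Rankin's trick: every set counted has weight y ^ (n ∸ ℓ) in the expansion of the product.
countGoodWith-weight : ∀ y {n} (c : Fin n → Fin t) σ ℓ →
  countGoodWith c σ ℓ * y ^ n ≤ y ^ ℓ * blockWeight y c σ
countGoodWith-weight y {zero} c σ ℓ =
  ≤-trans (≤-reflexive (*-identityʳ (countGoodWith c σ ℓ))) (length-filter-[x]-≤ (goodWith? c σ ℓ) [] empty-weight)
  where
  empty-weight : GoodWith c σ ℓ [] → 1 ≤ y ^ ℓ * blockWeight y c σ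
  empty-weight (refl , notOne) =
    *-monoʳ-≤ 1 (∏-positive _ λ i → Φ-positive y (σ i) (notOne i ∘ trans (+-identityʳ (σ i))))
countGoodWith-weight y {suc n} c σ ℓ = begin
    countGoodWith c σ ℓ * (y * y ^ n)                       ≡⟨ cong (_* (y * y ^ n)) (countGoodWith-split c σ ℓ) ⟩
    (#in ℓ + #out) * (y * y ^ n)                             ≡⟨ *-distribʳ-+ (y * y ^ n) (#in ℓ) #out ⟩
    #in ℓ * (y * y ^ n) + #out * (y * y ^ n)                 ≤⟨ +-mono-≤ (inside-bound ℓ) outside-bound ⟩
    y ^ ℓ * W′ + y ^ ℓ * (y * W)                             ≡⟨ *-distribˡ-+ (y ^ ℓ) W′ (y * W) ⟨
    y ^ ℓ * (W′ + y * W)                                     ≡⟨ cong (y ^ ℓ *_) (+-comm W′ (y * W)) ⟩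
    y ^ ℓ * (y * W + W′)                                     ≡⟨ cong (y ^ ℓ *_) (blockWeight-afterHead y c σ) ⟨
    y ^ ℓ * blockWeight y c σ                                ∎
  where
  open ≤-Reasoning
  W = blockWeight y (c ∘ suc) σ
  W′ = blockWeight y (c ∘ suc) (afterHead c σ)
  #in : ℕ → ℕ
  #in ℓ = countGoodWithHead c σ ℓ inside
  #out = countGoodWithHead c σ ℓ outside
  inside-bound : ∀ ℓ → #in ℓ * (y * y ^ n) ≤ y ^ ℓ * W′
  inside-bound zero = ≤-trans (≤-reflexive (cong (_* (y * y ^ n)) (countGoodWithHead-inside-zero c σ))) z≤n
  inside-bound (suc ℓ) = begin
      #in (suc ℓ) * (y * y ^ n)
    ≡⟨ x∙yz≈y∙xz (#in (suc ℓ)) y (y ^ n) ⟩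
      y * (#in (suc ℓ) * y ^ n)
    ≤⟨ *-monoʳ-≤ y (*-monoˡ-≤ (y ^ n) (countGoodWithHead-inside-≤ c σ ℓ)) ⟩
      y * (countGoodWith (c ∘ suc) (afterHead c σ) ℓ * y ^ n)
    ≤⟨ *-monoʳ-≤ y (countGoodWith-weight y (c ∘ suc) (afterHead c σ) ℓ) ⟩
      y * (y ^ ℓ * W′)
    ≡⟨ *-assoc y (y ^ ℓ) W′ ⟨
      y ^ suc ℓ * W′
    ∎
  outside-bound : #out * (y * y ^ n) ≤ y ^ ℓ * (y * W)
  outside-bound = begin
      #out * (y * y ^ n)
    ≡⟨ x∙yz≈y∙xz #out y (y ^ n) ⟩
      y * (#out * y ^ n)
    ≤⟨ *-monoʳ-≤ y (*-monoˡ-≤ (y ^ n) (countGoodWithHead-outside-≤ c σ ℓ)) ⟩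
      y * (countGoodWith (c ∘ suc) σ ℓ * y ^ n)
    ≤⟨ *-monoʳ-≤ y (countGoodWith-weight y (c ∘ suc) σ ℓ) ⟩
      y * (y ^ ℓ * W)
    ≡⟨ x∙yz≈y∙xz y (y ^ ℓ) W ⟩
      y ^ ℓ * (y * W)
    ∎

Φ-saturated : ∀ y s m → Φ y (2 + s) m ≡ suc y ^ m
Φ-saturated y s zero = refl
Φ-saturated y s (suc m) = begin
  y * Φ y (2 + s) m + Φ y (3 + s) m  ≡⟨ cong₂ (λ a b → y * a + b) (Φ-saturated y s m) (Φ-saturated y (suc s) m) ⟩
  y * suc y ^ m + suc y ^ m          ≡⟨ +-comm (y * suc y ^ m) _ ⟩
  suc y ^ suc m                      ∎
  where open ≡-Reasoning

Φ₁-+-^ : ∀ y m → Φ y 1 m + y ^ m ≡ suc y ^ m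
Φ₁-+-^ y zero = refl
Φ₁-+-^ y (suc m) = begin
  y * Φ y 1 m + Φ y 2 m + y * y ^ m    ≡⟨ cong (λ b → y * Φ y 1 m + b + y * y ^ m) (Φ-saturated y 0 m) ⟩
  y * Φ y 1 m + suc y ^ m + y * y ^ m  ≡⟨ regroup y (Φ y 1 m) (suc y ^ m) (y ^ m) ⟩
  y * (Φ y 1 m + y ^ m) + suc y ^ m    ≡⟨ cong (λ b → y * b + suc y ^ m) (Φ₁-+-^ y m) ⟩
  y * suc y ^ m + suc y ^ m            ≡⟨ +-comm (y * suc y ^ m) _ ⟩
  suc y ^ suc m                        ∎
  where
  open ≡-Reasoning
  regroup : ∀ y a b c → y * a + b + y * c ≡ y * (a + c) + b
  regroup = solve-∀

Φ₁-suc : ∀ y m → Φ y 1 (suc m) ≡ y * Φ y 1 m + Φ y 1 m + y ^ m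
Φ₁-suc y m = begin
  y * Φ y 1 m + Φ y 2 m            ≡⟨ cong (y * Φ y 1 m +_) (trans (Φ-saturated y 0 m) (sym (Φ₁-+-^ y m))) ⟩
  y * Φ y 1 m + (Φ y 1 m + y ^ m)  ≡⟨ +-assoc (y * Φ y 1 m) _ _ ⟨
  y * Φ y 1 m + Φ y 1 m + y ^ m    ∎
  where open ≡-Reasoning

suc-^-≥-leading : ∀ z k → z ^ suc k + suc k * z ^ k ≤ suc z ^ suc k
suc-^-≥-leading z zero = ≤-reflexive (+-comm (z * 1) 1)
suc-^-≥-leading z (suc k) = begin
  z * z ^ suc k + suc (suc k) * z ^ suc k                       ≤⟨ m≤m+n _ _ ⟩
  z * z ^ suc k + suc (suc k) * z ^ suc k + suc k * z ^ k       ≡⟨ factor z k (z ^ k) ⟩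
  suc z * (z ^ suc k + suc k * z ^ k)                            ≤⟨ *-monoʳ-≤ (suc z) (suc-^-≥-leading z k) ⟩
  suc z * suc z ^ suc k                                          ∎
  where
  open ≤-Reasoning
  factor : ∀ z k w → z * (z * w) + (2 + k) * (z * w) + (1 + k) * w ≡ (1 + z) * (z * w + (1 + k) * w)
  factor = solve-∀

^-suc-square : ∀ b m → b ^ (suc m * suc m) ≡ b ^ (m * m) * (b * b ^ (m + m))
^-suc-square b m = trans (cong (b ^_) (square m)) (^-distribˡ-+-* b (m * m) (suc (m + m)))
  where
  square : ∀ m → (1 + m) * (1 + m) ≡ m * m + (1 + (m + m))
  square = solve-∀

suc-^-suc-square-≥ : ∀ z m →
  suc z ^ (m * m) * (z * z ^ (m + m) + suc (m + m) * z ^ (m + m)) ≤ suc z ^ (suc m * suc m)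
suc-^-suc-square-≥ z m = ≤-trans
  (*-monoʳ-≤ (suc z ^ (m * m)) (suc-^-≥-leading z (m + m)))
  (≤-reflexive (sym (^-suc-square (suc z) m)))

2mn≤n²+m² : ∀ m n → 2 * m * n ≤ n * n + m * m
2mn≤n²+m² m n with ≤-total m n
... | inj₁ m≤n with d , refl ← m≤n⇒∃[o]m+o≡n m≤n = begin
  2 * m * (m + d)                      ≤⟨ m≤m+n _ (d * d) ⟩
  2 * m * (m + d) + d * d              ≡⟨ square-gap m d ⟩
  (m + d) * (m + d) + m * m            ∎
  where
  open ≤-Reasoning
  square-gap : ∀ m d → 2 * m * (m + d) + d * d ≡ (m + d) * (m + d) + m * m
  square-gap = solve-∀
... | inj₂ n≤m with d , refl ← m≤n⇒∃[o]m+o≡n n≤m = begin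
  2 * (n + d) * n                      ≤⟨ m≤m+n _ (d * d) ⟩
  2 * (n + d) * n + d * d              ≡⟨ square-gap n d ⟩
  n * n + (n + d) * (n + d)            ∎
  where
  open ≤-Reasoning
  square-gap : ∀ n d → 2 * (n + d) * n + d * d ≡ n * n + (n + d) * (n + d)
  square-gap = solve-∀

Φ₁-step-≤ : ∀ m y → 2 * m * (y + 1) * y + y * y ≤ 2 * (m + 1) * (y * y + suc (m + m))
Φ₁-step-≤ m y = begin
    2 * m * (y + 1) * y + y * y
  ≡⟨ expand m y ⟩
    2 * m * y * y + 2 * m * y + y * y
  ≤⟨ +-monoˡ-≤ (y * y) (+-monoʳ-≤ (2 * m * y * y) (2mn≤n²+m² m y)) ⟩
    2 * m * y * y + (y * y + m * m) + y * y
  ≤⟨ m≤m+n _ _ ⟩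
    2 * m * y * y + (y * y + m * m) + y * y + (3 * m * m + 6 * m + 2)
  ≡⟨ factor m y ⟩
    2 * (m + 1) * (y * y + suc (m + m))
  ∎
  where
  open ≤-Reasoning
  expand : ∀ m y → 2 * m * (y + 1) * y + y * y ≡ 2 * m * y * y + 2 * m * y + y * y
  expand = solve-∀
  factor : ∀ m y →
    2 * m * y * y + (y * y + m * m) + y * y + (3 * m * m + 6 * m + 2) ≡ 2 * (m + 1) * (y * y + suc (m + m))
  factor = solve-∀

-- Φ y 1 m ≤ (2m / y) y ^ m (1 + 1/y²) ^ (m²): the companion of Φ₀-bound its induction needs.
Φ₁-bound : ∀ y m → Φ y 1 m * (y * y) ^ (m * m) * y ≤ 2 * m * y ^ m * suc (y * y) ^ (m * m)
Φ₁-bound y zero = z≤n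
Φ₁-bound y (suc m) = begin
    Φ y 1 (suc m) * z ^ (suc m * suc m) * y
  ≡⟨ cong₂ (λ p q → p * q * y) (Φ₁-suc y m) (^-suc-square z m) ⟩
    (y * a + a + Y) * (Z * (z * W)) * y
  ≡⟨ expand y a Y Z W ⟩
    (y + 1) * (z * W) * (a * Z * y) + Y * Z * (z * W * y)
  ≤⟨ +-mono-≤ (*-monoʳ-≤ ((y + 1) * (z * W)) (Φ₁-bound y m)) (*-monoˡ-≤ (z * W * y) (*-monoʳ-≤ Y Z≤H)) ⟩
    (y + 1) * (z * W) * (2 * m * Y * H) + Y * H * (z * W * y)
  ≡⟨ collect y m Y H W ⟩
    Y * H * W * y * (2 * m * (y + 1) * y + y * y)
  ≤⟨ *-monoʳ-≤ (Y * H * W * y) (Φ₁-step-≤ m y) ⟩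
    Y * H * W * y * (2 * (m + 1) * (y * y + suc (m + m)))
  ≡⟨ factor y m Y H W ⟩
    2 * suc m * (y * Y) * (H * (z * W + suc (m + m) * W))
  ≤⟨ *-monoʳ-≤ (2 * suc m * (y * Y)) (suc-^-suc-square-≥ z m) ⟩
    2 * suc m * (y * Y) * suc z ^ (suc m * suc m)
  ∎
  where
  open ≤-Reasoning
  z = y * y
  a = Φ y 1 m
  Y = y ^ m
  Z = z ^ (m * m)
  H = suc z ^ (m * m)
  W = z ^ (m + m)
  Z≤H : Z ≤ H
  Z≤H = ^-monoˡ-≤ (m * m) (n≤1+n z)
  expand : ∀ y a Y Z W →
    (y * a + a + Y) * (Z * (y * y * W)) * y ≡ (y + 1) * (y * y * W) * (a * Z * y) + Y * Z * (y * y * W * y)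
  expand = solve-∀
  collect : ∀ y m Y H W →
    (y + 1) * (y * y * W) * (2 * m * Y * H) + Y * H * (y * y * W * y) ≡ Y * H * W * y * (2 * m * (y + 1) * y + y * y)
  collect = solve-∀
  factor : ∀ y m Y H W →
    Y * H * W * y * (2 * (m + 1) * (y * y + suc (m + m))) ≡ 2 * (1 + m) * (y * Y) * (H * (y * y * W + (1 + (m + m)) * W))
  factor = solve-∀

Φ₀-bound : ∀ y m → Φ y 0 m * (y * y) ^ (m * m) ≤ y ^ m * suc (y * y) ^ (m * m)
Φ₀-bound y zero = ≤-refl
Φ₀-bound y (suc m) = begin
    (y * b + a) * z ^ (suc m * suc m)
  ≡⟨ cong ((y * b + a) *_) (^-suc-square z m) ⟩
    (y * b + a) * (Z * (z * W))
  ≡⟨ expand y a b Z W ⟩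
    y * (z * W) * (b * Z) + y * W * (a * Z * y)
  ≤⟨ +-mono-≤ (*-monoʳ-≤ (y * (z * W)) (Φ₀-bound y m)) (*-monoʳ-≤ (y * W) (Φ₁-bound y m)) ⟩
    y * (z * W) * (Y * H) + y * W * (2 * m * Y * H)
  ≡⟨ factor y m Y H W ⟩
    y * Y * (H * (z * W + (m + m) * W))
  ≤⟨ *-monoʳ-≤ (y * Y) (*-monoʳ-≤ H (+-monoʳ-≤ (z * W) (*-monoˡ-≤ W (n≤1+n (m + m))))) ⟩
    y * Y * (H * (z * W + suc (m + m) * W))
  ≤⟨ *-monoʳ-≤ (y * Y) (suc-^-suc-square-≥ z m) ⟩
    y * Y * suc z ^ (suc m * suc m)
  ∎
  where
  open ≤-Reasoning
  z = y * y
  a = Φ y 1 m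
  b = Φ y 0 m
  Y = y ^ m
  Z = z ^ (m * m)
  H = suc z ^ (m * m)
  W = z ^ (m + m)
  expand : ∀ y a b Z W → (y * b + a) * (Z * (y * y * W)) ≡ y * (y * y * W) * (b * Z) + y * W * (a * Z * y)
  expand = solve-∀
  factor : ∀ y m Y H W →
    y * (y * y * W) * (Y * H) + y * W * (2 * m * Y * H) ≡ y * Y * (H * (y * y * W + (m + m) * W))
  factor = solve-∀

^-distribʳ-* : ∀ a b k → (a * b) ^ k ≡ a ^ k * b ^ k
^-distribʳ-* a b zero = refl
^-distribʳ-* a b (suc k) = trans (cong (a * b *_) (^-distribʳ-* a b k)) (interchange a b (a ^ k) (b ^ k))

^-*-mono-≤ : ∀ {a b c} k → a * b ≤ c → a ^ k * b ^ k ≤ c ^ k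
^-*-mono-≤ {a} {b} k ab≤c = ≤-trans (≤-reflexive (sym (^-distribʳ-* a b k))) (^-monoˡ-≤ k ab≤c)

-- (1 + 1/z) ^ k ≤ 1 + k/z + (k/z)², cleared of denominators.
suc-^-≤-quadratic : ∀ z k → k ≤ z → suc z ^ k * (z * z) ≤ z ^ k * (z * z + k * z + k * k)
suc-^-≤-quadratic z zero _ = ≤-reflexive (base z)
  where
  base : ∀ z → 1 * (z * z) ≡ 1 * (z * z + 0 * z + 0 * 0)
  base = solve-∀
suc-^-≤-quadratic z (suc k) k<z = begin
    suc z * suc z ^ k * (z * z)
  ≡⟨ *-assoc (suc z) (suc z ^ k) (z * z) ⟩
    suc z * (suc z ^ k * (z * z))
  ≤⟨ *-monoʳ-≤ (suc z) (suc-^-≤-quadratic z k (<⇒≤ k<z)) ⟩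
    suc z * (z ^ k * (z * z + k * z + k * k))
  ≡⟨ expand z k (z ^ k) ⟩
    z ^ k * (P + k * k)
  ≤⟨ *-monoʳ-≤ (z ^ k) (+-monoʳ-≤ P k²≤) ⟩
    z ^ k * (P + (k * z + z))
  ≡⟨ factor z k (z ^ k) ⟩
    z * z ^ k * (z * z + suc k * z + suc k * suc k)
  ∎
  where
  open ≤-Reasoning
  P = z * z * z + k * z * z + k * k * z + z * z + k * z
  k²≤ : k * k ≤ k * z + z
  k²≤ = ≤-trans (*-monoʳ-≤ k (<⇒≤ k<z)) (m≤m+n _ _)
  expand : ∀ z k w →
    (1 + z) * (w * (z * z + k * z + k * k)) ≡ w * (z * z * z + k * z * z + k * k * z + z * z + k * z + k * k)
  expand = solve-∀
  factor : ∀ z k w →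
    w * (z * z * z + k * z * z + k * k * z + z * z + k * z + (k * z + z)) ≡ z * w * (z * z + (1 + k) * z + (1 + k) * (1 + k))
  factor = solve-∀

suc-^-self-≤ : ∀ z .{{_ : NonZero z}} → suc z ^ z ≤ 3 * z ^ z
suc-^-self-≤ z = *-cancelʳ-≤ _ _ (z * z) {{m*n≢0 z z}} (begin
    suc z ^ z * (z * z)               ≤⟨ suc-^-≤-quadratic z z ≤-refl ⟩
    z ^ z * (z * z + z * z + z * z)   ≡⟨ triple (z ^ z) (z * z) ⟩
    3 * z ^ z * (z * z)               ∎)
  where
  open ≤-Reasoning
  triple : ∀ a b → a * (b + b + b) ≡ 3 * a * b
  triple = solve-∀

-- (1 + 1/z) ^ q ≤ 3 ^ e whenever q ≤ e z, cleared of denominators.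
suc-^-≤-3^ : ∀ z .{{_ : NonZero z}} e q → q ≤ e * z → suc z ^ q ≤ 3 ^ e * z ^ q
suc-^-≤-3^ z e q q≤ez with d , q+d≡ez ← m≤n⇒∃[o]m+o≡n q≤ez =
  *-cancelʳ-≤ _ _ (z ^ d) {{m^n≢0 z d}} (begin
    suc z ^ q * z ^ d          ≤⟨ *-monoʳ-≤ (suc z ^ q) (^-monoˡ-≤ d (n≤1+n z)) ⟩
    suc z ^ q * suc z ^ d      ≡⟨ ^-distribˡ-+-* (suc z) q d ⟨
    suc z ^ (q + d)            ≡⟨ cong (suc z ^_) q+d≡zе ⟩
    suc z ^ (z * e)            ≡⟨ ^-*-assoc (suc z) z e ⟨
    (suc z ^ z) ^ e            ≤⟨ ^-monoˡ-≤ e (suc-^-self-≤ z) ⟩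
    (3 * z ^ z) ^ e            ≡⟨ ^-distribʳ-* 3 (z ^ z) e ⟩
    3 ^ e * (z ^ z) ^ e        ≡⟨ cong (3 ^ e *_) (trans (^-*-assoc z z e) (cong (z ^_) (sym q+d≡zе))) ⟩
    3 ^ e * z ^ (q + d)        ≡⟨ cong (3 ^ e *_) (^-distribˡ-+-* z q d) ⟩
    3 ^ e * (z ^ q * z ^ d)    ≡⟨ *-assoc (3 ^ e) (z ^ q) (z ^ d) ⟨
    3 ^ e * z ^ q * z ^ d      ∎)
  where
  open ≤-Reasoning
  q+d≡zе : q + d ≡ z * e
  q+d≡zе = trans q+d≡ez (*-comm e z)

switch-point : {P : ℕ → Set} → Decidable P → ∀ N → P 0 → ¬ P N → ∃ λ k → P k × ¬ P (suc k)
switch-point P? zero p₀ ¬p = contradiction p₀ ¬p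
switch-point P? (suc N) p₀ ¬p with P? N
... | yes pN = N , pN , ¬p
... | no ¬pN = switch-point P? N p₀ ¬pN

-- y = 2 + k is the least integer ≥ 2 with Q ≤ ℓ y², so ℓ y² ≤ 4 ℓ (y − 1)² ≤ 4 Q.
∃-scale : ∀ ℓ .{{_ : NonZero ℓ}} Q → ℓ ≤ Q →
  ∃ λ k → Q ≤ ℓ * ((2 + k) * (2 + k)) × ℓ * ((2 + k) * (2 + k)) ≤ 4 * Q
∃-scale ℓ Q ℓ≤Q =
  let k , below , ¬below = switch-point (λ k → ℓ * (suc k * suc k) ≤? Q) Q ℓ*1≤Q (<⇒≱ Q<ℓ*[1+Q]²)
  in k , <⇒≤ (≰⇒> ¬below) , (begin
    ℓ * ((2 + k) * (2 + k))                                       ≤⟨ m≤m+n _ _ ⟩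
    ℓ * ((2 + k) * (2 + k)) + ℓ * (3 * k * k + 4 * k)             ≡⟨ quadruple ℓ k ⟩
    4 * (ℓ * ((1 + k) * (1 + k)))                                 ≤⟨ *-monoʳ-≤ 4 below ⟩
    4 * Q                                                         ∎)
  where
  open ≤-Reasoning
  ℓ*1≤Q : ℓ * 1 ≤ Q
  ℓ*1≤Q = ≤-trans (≤-reflexive (*-identityʳ ℓ)) ℓ≤Q
  Q<ℓ*[1+Q]² : Q < ℓ * (suc Q * suc Q)
  Q<ℓ*[1+Q]² = ≤-trans (m≤m*n (suc Q) (suc Q)) (m≤n*m _ ℓ)
  quadruple : ∀ ℓ k → ℓ * ((2 + k) * (2 + k)) + ℓ * (3 * k * k + 4 * k) ≡ 4 * (ℓ * ((1 + k) * (1 + k)))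
  quadruple = solve-∀

exponent-choice : ∀ ℓ z Q → Q ≤ ℓ * z → ℓ * z ≤ 4 * Q →
  ∃ λ e → Q + Q ≤ e * z × (ℓ * z) ^ ℓ * 3 ^ e ≤ (20 * Q) ^ ℓ
exponent-choice ℓ z Q Q≤ℓz ℓz≤4Q with ℓ * z ≤? Q + Q
... | yes ℓz≤2Q = ℓ + ℓ , 2Q≤2ℓz , (begin
    (ℓ * z) ^ ℓ * 3 ^ (ℓ + ℓ)    ≡⟨ cong ((ℓ * z) ^ ℓ *_) (trans (^-distribˡ-+-* 3 ℓ ℓ) (sym (^-distribʳ-* 3 3 ℓ))) ⟩
    (ℓ * z) ^ ℓ * 9 ^ ℓ          ≤⟨ ^-*-mono-≤ ℓ (≤-trans (*-monoˡ-≤ 9 ℓz≤2Q) (≤-reflexive (times9 Q))) ⟩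
    (18 * Q) ^ ℓ                 ≤⟨ ^-monoˡ-≤ ℓ (*-monoˡ-≤ Q (m≤m+n 18 2)) ⟩
    (20 * Q) ^ ℓ                 ∎)
  where
  open ≤-Reasoning
  2Q≤2ℓz = ≤-trans (+-mono-≤ Q≤ℓz Q≤ℓz) (≤-reflexive (sym (*-distribʳ-+ z ℓ ℓ)))
  times9 : ∀ Q → (Q + Q) * 9 ≡ 18 * Q
  times9 = solve-∀
... | no ℓz≰2Q = ℓ , <⇒≤ (≰⇒> ℓz≰2Q) , (begin
    (ℓ * z) ^ ℓ * 3 ^ ℓ          ≤⟨ ^-*-mono-≤ ℓ (≤-trans (*-monoˡ-≤ 3 ℓz≤4Q) (≤-reflexive (times3 Q))) ⟩
    (12 * Q) ^ ℓ                 ≤⟨ ^-monoˡ-≤ ℓ (*-monoˡ-≤ Q (m≤m+n 12 8)) ⟩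
    (20 * Q) ^ ℓ                 ∎)
  where
  open ≤-Reasoning
  times3 : ∀ Q → 4 * Q * 3 ≡ 12 * Q
  times3 = solve-∀

∑-block-sizes : ∀ {n} (c : Fin n → Fin t) → ∑ (λ i → ∣ block c i ∣) ≡ n
∑-block-sizes {t = t} {n = zero} c = ∑-zero {t}
∑-block-sizes {n = suc n} c = trans
  (∑-incrementAt (c zero) _ (λ i → ∣ block (c ∘ suc) i ∣)
    (trans (∣bit∷∣ (d (c zero)) (X (c zero))) (bump-yes (d (c zero)) refl _))
    (λ i c₀≢i → trans (∣bit∷∣ (d i) (X i)) (bump-no (d i) c₀≢i _)))
  (cong suc (∑-block-sizes (c ∘ suc)))
  where
  d = λ i → c zero ≟ i
  X = λ i → block (c ∘ suc) i

n≤sumSq : ∀ {n} (c : Fin n → Fin t) → n ≤ sumSq c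
n≤sumSq c = subst (_≤ sumSq c) (∑-block-sizes c) (∑-mono-≤ λ i → m≤m^2 ∣ block c i ∣)
  where
  m≤m^2 : ∀ m → m ≤ m ^ 2
  m≤m^2 zero = z≤n
  m≤m^2 m@(suc _) = m≤m*n m (m ^ 1)

countGood-large : ∀ {n ℓ} (c : Fin n → Fin t) → n < ℓ → countGood c ℓ ≡ 0
countGood-large {n = n} {ℓ} c n<ℓ = cong length (filter-none (good? c ℓ) (universal too-large (allSubsets n)))
  where
  too-large : ∀ S → ¬ Good c ℓ S
  too-large S (∣S∣≡ℓ , _) = <⇒≱ n<ℓ (subst (_≤ n) ∣S∣≡ℓ (∣p∣≤n S))

blockWeight₀-bound : ∀ y {n} (c : Fin n → Fin t) →
  blockWeight y c (λ _ → 0) * (y * y) ^ sumSq c ≤ y ^ n * suc (y * y) ^ sumSq c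
blockWeight₀-bound y {n} c = begin
    W₀ * z ^ sumSq c                                 ≡⟨ cong (λ q → W₀ * z ^ q) ∑m²≡sumSq ⟨
    W₀ * z ^ ∑ m²                                    ≡⟨ cong (W₀ *_) (∏-^ z m²) ⟨
    W₀ * ∏ (λ i → z ^ m² i)                          ≤⟨ ∏-*-mono-≤ _ _ _ _ (λ i → Φ₀-bound y (m i)) ⟩
    ∏ (λ i → y ^ m i) * ∏ (λ i → suc z ^ m² i)       ≡⟨ cong₂ _*_ (∏-^ y m) (∏-^ (suc z) m²) ⟩
    y ^ ∑ m * suc z ^ ∑ m²                           ≡⟨ cong₂ (λ p q → y ^ p * suc z ^ q) (∑-block-sizes c) ∑m²≡sumSq ⟩
    y ^ n * suc z ^ sumSq c                          ∎
  where
  open ≤-Reasoning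
  z = y * y
  W₀ = blockWeight y c (λ _ → 0)
  m = λ i → ∣ block c i ∣
  m² = λ i → m i * m i
  ∑m²≡sumSq : ∑ m² ≡ sumSq c
  ∑m²≡sumSq = ∑-cong (λ i → cong (m i *_) (sym (*-identityʳ (m i))))

countGood-weight : ∀ y .{{_ : NonZero y}} {n} (c : Fin n → Fin t) ℓ →
  countGood c ℓ * (y * y) ^ sumSq c ≤ y ^ ℓ * suc (y * y) ^ sumSq c
countGood-weight y {n} c ℓ = *-cancelʳ-≤ _ _ (y ^ n) {{m^n≢0 y n}} (begin
    N * z ^ Q * y ^ n                  ≡⟨ xy∙z≈xz∙y N (z ^ Q) (y ^ n) ⟩
    N * y ^ n * z ^ Q                  ≤⟨ *-monoˡ-≤ (z ^ Q) (countGoodWith-weight y c (λ _ → 0) ℓ) ⟩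
    y ^ ℓ * W₀ * z ^ Q                 ≡⟨ *-assoc (y ^ ℓ) W₀ (z ^ Q) ⟩
    y ^ ℓ * (W₀ * z ^ Q)               ≤⟨ *-monoʳ-≤ (y ^ ℓ) (blockWeight₀-bound y c) ⟩
    y ^ ℓ * (y ^ n * suc z ^ Q)        ≡⟨ x∙yz≈xz∙y (y ^ ℓ) (y ^ n) (suc z ^ Q) ⟩
    y ^ ℓ * suc z ^ Q * y ^ n          ∎)
  where
  open ≤-Reasoning
  N = countGood c ℓ
  Q = sumSq c
  z = y * y
  W₀ = blockWeight y c (λ _ → 0)

-- Squaring lets the exponent e of 3 approximate 2 Q / y² rather than Q / y².
countGood-squared-bound : ∀ {n} (c : Fin n → Fin t) ℓ y .{{_ : NonZero y}} e →
  sumSq c + sumSq c ≤ e * (y * y) → countGood c ℓ ^ 2 * ℓ ^ ℓ ≤ (ℓ * (y * y)) ^ ℓ * 3 ^ e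
countGood-squared-bound c ℓ y e 2Q≤ez = begin
    N * (N * 1) * ℓ ^ ℓ                ≡⟨ cong (λ k → N * k * ℓ ^ ℓ) (*-identityʳ N) ⟩
    N * N * ℓ ^ ℓ                      ≤⟨ *-monoˡ-≤ (ℓ ^ ℓ) N²≤ ⟩
    y ^ ℓ * y ^ ℓ * 3 ^ e * ℓ ^ ℓ      ≡⟨ regroup (y ^ ℓ) (3 ^ e) (ℓ ^ ℓ) ⟩
    ℓ ^ ℓ * (y ^ ℓ * y ^ ℓ) * 3 ^ e    ≡⟨ cong (λ p → ℓ ^ ℓ * p * 3 ^ e) (^-distribʳ-* y y ℓ) ⟨
    ℓ ^ ℓ * z ^ ℓ * 3 ^ e              ≡⟨ cong (_* 3 ^ e) (^-distribʳ-* ℓ z ℓ) ⟨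
    (ℓ * z) ^ ℓ * 3 ^ e                ∎
  where
  open ≤-Reasoning
  N = countGood c ℓ
  Q = sumSq c
  z = y * y
  instance _ = m*n≢0 y y
  regroup : ∀ a b c → a * a * b * c ≡ c * (a * a) * b
  regroup = solve-∀
  square : ∀ a b → a * a * (b * b) ≡ a * b * (a * b)
  square = solve-∀
  N²≤ : N * N ≤ y ^ ℓ * y ^ ℓ * 3 ^ e
  N²≤ = *-cancelʳ-≤ _ _ (z ^ (Q + Q)) {{m^n≢0 z (Q + Q)}} (begin
      N * N * z ^ (Q + Q)                          ≡⟨ cong (N * N *_) (^-distribˡ-+-* z Q Q) ⟩
      N * N * (z ^ Q * z ^ Q)                      ≡⟨ square N (z ^ Q) ⟩
      N * z ^ Q * (N * z ^ Q)                      ≤⟨ *-mono-≤ (countGood-weight y c ℓ) (countGood-weight y c ℓ) ⟩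
      y ^ ℓ * suc z ^ Q * (y ^ ℓ * suc z ^ Q)      ≡⟨ square (y ^ ℓ) (suc z ^ Q) ⟨
      y ^ ℓ * y ^ ℓ * (suc z ^ Q * suc z ^ Q)      ≡⟨ cong (y ^ ℓ * y ^ ℓ *_) (^-distribˡ-+-* (suc z) Q Q) ⟨
      y ^ ℓ * y ^ ℓ * suc z ^ (Q + Q)              ≤⟨ *-monoʳ-≤ (y ^ ℓ * y ^ ℓ) (suc-^-≤-3^ z e (Q + Q) 2Q≤ez) ⟩
      y ^ ℓ * y ^ ℓ * (3 ^ e * z ^ (Q + Q))        ≡⟨ *-assoc (y ^ ℓ * y ^ ℓ) (3 ^ e) (z ^ (Q + Q)) ⟨
      y ^ ℓ * y ^ ℓ * 3 ^ e * z ^ (Q + Q)          ∎)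

lemma6p20 : {n t : ℕ} (c : Fin n → Fin t) → (∀ i → 2 ≤ ∣ block c i ∣) → (ℓ : ℕ) → 2 ≤ ℓ →
    countGood c ℓ ^ 2 * ℓ ^ ℓ ≤ (20 * sumSq c) ^ ℓ
lemma6p20 {n} c _ ℓ@(suc _) _ with ℓ ≤? n
... | no ℓ≰n rewrite countGood-large c (≰⇒> ℓ≰n) = z≤n
... | yes ℓ≤n =
  let k , Q≤ℓz , ℓz≤4Q = ∃-scale ℓ (sumSq c) (≤-trans ℓ≤n (n≤sumSq c))
      e , 2Q≤ez , ≤20Q = exponent-choice ℓ ((2 + k) * (2 + k)) (sumSq c) Q≤ℓz ℓz≤4Q
  in ≤-trans (countGood-squared-bound c ℓ (2 + k) e 2Q≤ez) ≤20Q
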